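{- Let $B$ be a set of $n$ positive integers. Let $D,d$ be positive integers and $r$ a nonnegative integer with $\gcd(d,Dr)=1$, and suppose $A=\{D(r+di): 0\le i\le N-1\}\subseteq B.B=\{bb':b,b'\in B\}$, where $N>2n$. Let $G$ be the bipartite graph defined as follows: for each $a\in A$ fix one pair $(b,b')\in B\times B$ with $b\le b'$ and $bb'=a$; the vertex set of $G$ is the disjoint union of two copies $B_1,B_2$ of $B$, and for each $a\in A$ there is an edge between the copy of $b$ in $B_1$ and the copy of $b'$ in $B_2$, where $(b,b')$ is the pair fixed for $a$ (so $G$ has $N$ edges, distinct edges corresponding to distinct elements of $A$). If $G$ contains a cycle of length $2k$, then $r\le N^k$ and $d\le N^k$. -}

module Defs where

open import Data.Nat using (ℕ; zero; suc; _+_; _*_; _≤_; _<_)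
open import Data.Nat.DivMod using (_%_; m%n<n)
open import Data.Fin using (Fin; toℕ; fromℕ<)
open import Data.Product using (_×_; _,_)
open import Data.List using (List)
open import Data.List.Membership.Propositional using (_∈_)
open import Function.Definitions using (Injective)
open import Relation.Binary.PropositionalEquality using (_≡_)

next : ∀ {m} → Fin (suc m) → Fin (suc m)
next {m} j = fromℕ< (m%n<n (suc (toℕ j)) (suc m))

record PairChoice (B : List ℕ) (D r d N : ℕ) (pair : Fin N → ℕ × ℕ) : Set where
  field
    fst∈B   : ∀ i → (let (b , b') = pair i in b ∈ B)
    snd∈B   : ∀ i → (let (b , b') = pair i in b' ∈ B)
    ordered : ∀ i → (let (b , b') = pair i in b ≤ b')
    product : ∀ i → (let (b , b') = pair i in b * b' ≡ D * (r + d * toℕ i))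

-- A cycle of length 2k (k = suc m ≥ 2) in G: distinct vertices
-- v₀ , w₀ , v₁ , w₁ , … , v_{k-1} , w_{k-1} (vⱼ ∈ B₁, wⱼ ∈ B₂) with
-- vⱼ — wⱼ an edge and wⱼ — v_{j+1 mod k} an edge.
-- (For k ≥ 2 distinct vertices force the 2k edges to be distinct.)
record Cycle {N : ℕ} (pair : Fin N → ℕ × ℕ) (k : ℕ) : Set where
  field
    m       : ℕ
    k≡      : k ≡ suc m
    2≤k     : 2 ≤ k
    v       : Fin (suc m) → ℕ
    w       : Fin (suc m) → ℕ
    v-inj   : Injective _≡_ _≡_ v
    w-inj   : Injective _≡_ _≡_ w
    e       : Fin (suc m) → Fin N
    e'      : Fin (suc m) → Fin N
    e-edge  : ∀ j → pair (e j) ≡ (v j , w j)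
    e'-edge : ∀ j → pair (e' j) ≡ (v (next j) , w j)

-- Going once around the cycle, the edges vⱼ — wⱼ carry the labels D (r + d xⱼ) and the edges
-- wⱼ — vⱼ₊₁ the labels D (r + d yⱼ); both families multiply to ∏ vⱼ · ∏ wⱼ, so
-- ∏ (r + d xⱼ) = ∏ (r + d yⱼ), where all xⱼ, yⱼ < N and x₀ differs from every yⱼ.
-- Expanding both sides gives Σ cᵢ rᵏ⁻ⁱ dⁱ = Σ c′ᵢ rᵏ⁻ⁱ dⁱ, with cᵢ, c′ᵢ the coefficients of
-- ∏ (X + xⱼ) and ∏ (X + yⱼ). These polynomials differ, since -x₀ is a root of the first only,
-- and their coefficients are at most ∏ (1 + xⱼ) ≤ Nᵏ. At the first index where cᵢ ≠ c′ᵢ,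
-- d divides rᵏ⁻ⁱ (cᵢ - c′ᵢ), hence cᵢ - c′ᵢ because gcd (d , r) = 1, so d ≤ Nᵏ.
-- The same argument with r and d exchanged gives r ≤ Nᵏ.

module Submission where

open import Defs
open import Data.Nat
  using (ℕ; zero; suc; _+_; _*_; _^_; _≤_; _<_; z≤n; s≤s; s≤s⁻¹; ∣_-_∣; _⊔_; NonZero; ≢-nonZero; >-nonZero)
open import Data.Nat.Properties
open import Data.Nat.Divisibility using (_∣_; ∣⇒≤; divides; ∣-trans; n∣m*n)
open import Data.Nat.Coprimality using (Coprime; coprime-divisor; gcd≡1⇒coprime)
import Data.Nat.Coprimality as Coprime
open import Data.Nat.DivMod using (_%_; m<n⇒m%n≡m; n%n≡0)
open import Data.Nat.GCD using (gcd)
open import Data.Integer using (ℤ; +_; 0ℤ)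
import Data.Integer as ℤ
import Data.Integer.Properties as ℤ
open import Data.Integer.Tactic.RingSolver using (solve-∀)
open import Data.Fin using (Fin; zero; suc; toℕ; inject₁; fromℕ)
open import Data.Fin.Properties using (toℕ-fromℕ<; toℕ-inject₁; toℕ-fromℕ; toℕ-injective; toℕ<n)
open import Data.Vec using (Vec; []; _∷_)
open import Data.Vec.Relation.Unary.All using ([]; _∷_)
import Data.Vec.Relation.Unary.All as Vec
open import Data.Product using (_×_; _,_; proj₁; proj₂; uncurry)
open import Data.Sum using (inj₁; inj₂)
open import Data.List using (List; length)
open import Data.List.Relation.Unary.All using (All)
open import Data.List.Relation.Unary.Unique.Propositional using (Unique)
open import Function using (_∘_; const)
open import Relation.Binary.PropositionalEquality
open import Relation.Nullary using (yes; no; contradiction)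

open import Algebra.Properties.CommutativeMonoid.Sum *-1-commutativeMonoid
  using () renaming (sum to ∏; sum-cong-≗ to ∏-cong; ∑-distrib-+ to ∏-distrib-*;
                     sum-init-last to ∏-init-last)
open import Algebra.Properties.CommutativeMonoid.Sum ℤ.*-1-commutativeMonoid
  using () renaming (sum to ∏ℤ; sum-cong-≗ to ∏ℤ-cong)

private variable
  n : ℕ

∏-const : ∀ n c → ∏ {n} (const c) ≡ c ^ n
∏-const zero    c = refl
∏-const (suc n) c = cong (c *_) (∏-const n c)

∏-mono-≤ : ∀ {f g : Fin n → ℕ} → (∀ j → f j ≤ g j) → ∏ f ≤ ∏ g
∏-mono-≤ {zero}  f≤g = ≤-refl
∏-mono-≤ {suc n} f≤g = *-mono-≤ (f≤g zero) (∏-mono-≤ (f≤g ∘ suc))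

pos-∏ : ∀ (f : Fin n → ℕ) → + ∏ f ≡ ∏ℤ (+_ ∘ f)
pos-∏ {zero}  f = refl
pos-∏ {suc n} f = trans (ℤ.pos-* (f zero) _) (cong (+ f zero ℤ.*_) (pos-∏ (f ∘ suc)))

pos-^ : ∀ t n → + (t ^ n) ≡ (+ t) ℤ.^ n
pos-^ t zero    = refl
pos-^ t (suc n) = trans (ℤ.pos-* t (t ^ n)) (cong (+ t ℤ.*_) (pos-^ t n))

next-inject₁ : (i : Fin n) → next (inject₁ i) ≡ suc i
next-inject₁ {n} i = toℕ-injective (begin
  toℕ (next (inject₁ i))     ≡⟨ toℕ-fromℕ< _ ⟩
  suc (toℕ (inject₁ i)) % suc n ≡⟨ cong (λ z → suc z % suc n) (toℕ-inject₁ i) ⟩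
  suc (toℕ i) % suc n        ≡⟨ m<n⇒m%n≡m (s≤s (toℕ<n i)) ⟩
  suc (toℕ i)                ∎)
  where open ≡-Reasoning

next-fromℕ : ∀ n → next (fromℕ n) ≡ zero
next-fromℕ n = toℕ-injective (begin
  toℕ (next (fromℕ n))        ≡⟨ toℕ-fromℕ< _ ⟩
  suc (toℕ (fromℕ n)) % suc n ≡⟨ cong (λ z → suc z % suc n) (toℕ-fromℕ n) ⟩
  suc n % suc n               ≡⟨ n%n≡0 (suc n) ⟩
  0                           ∎)
  where open ≡-Reasoning

next-zero≢zero : 1 ≤ n → next {n} zero ≢ zero
next-zero≢zero {n} 1≤n next0≡0 = 1+n≢0 (begin
  1              ≡⟨ m<n⇒m%n≡m (s≤s 1≤n) ⟨
  1 % suc n      ≡⟨ toℕ-fromℕ< _ ⟨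
  toℕ (next {n} zero) ≡⟨ cong toℕ next0≡0 ⟩
  0              ∎)
  where open ≡-Reasoning

∏-rotate : (g : Fin (suc n) → ℕ) → ∏ (g ∘ next) ≡ ∏ g
∏-rotate {n} g = begin
  ∏ (g ∘ next)                                ≡⟨ ∏-init-last (g ∘ next) ⟩
  ∏ (g ∘ next ∘ inject₁) * g (next (fromℕ n))
    ≡⟨ cong₂ _*_ (∏-cong (cong g ∘ next-inject₁)) (cong g (next-fromℕ n)) ⟩
  ∏ (g ∘ suc) * g zero                        ≡⟨ *-comm _ (g zero) ⟩
  ∏ g                                         ∎
  where open ≡-Reasoning

homEval : ℕ → ℕ → Vec ℕ n → ℕ
homEval         t s []       = 0
homEval {suc n} t s (c ∷ cs) = c * t ^ n + s * homEval t s cs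

homEvalℤ : ℤ → ℤ → Vec ℕ n → ℤ
homEvalℤ         t s []       = 0ℤ
homEvalℤ {suc n} t s (c ∷ cs) = + c ℤ.* t ℤ.^ n ℤ.+ s ℤ.* homEvalℤ t s cs

pos-homEval : ∀ t s (cs : Vec ℕ n) → + homEval t s cs ≡ homEvalℤ (+ t) (+ s) cs
pos-homEval         t s []       = refl
pos-homEval {suc n} t s (c ∷ cs) = begin
  + (c * t ^ n + s * homEval t s cs)          ≡⟨ ℤ.pos-+ (c * t ^ n) _ ⟩
  + (c * t ^ n) ℤ.+ + (s * homEval t s cs)    ≡⟨ cong₂ ℤ._+_ (ℤ.pos-* c _) (ℤ.pos-* s _) ⟩
  + c ℤ.* + (t ^ n) ℤ.+ + s ℤ.* + homEval t s cs
    ≡⟨ cong₂ (λ x y → + c ℤ.* x ℤ.+ + s ℤ.* y) (pos-^ t n) (pos-homEval t s cs) ⟩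
  homEvalℤ (+ t) (+ s) (c ∷ cs)               ∎
  where open ≡-Reasoning

-- Multiplies the form with coefficients cs by p t + q s; carry is q times the previous coefficient.
mulLinear : ℕ → ℕ → ℕ → Vec ℕ n → Vec ℕ (suc n)
mulLinear p q carry []       = carry ∷ []
mulLinear p q carry (c ∷ cs) = p * c + carry ∷ mulLinear p q (q * c) cs

coeffs : (p q : Fin n → ℕ) → Vec ℕ (suc n)
coeffs {zero}  p q = 1 ∷ []
coeffs {suc n} p q = mulLinear (p zero) (q zero) 0 (coeffs (p ∘ suc) (q ∘ suc))

linProd : ℕ → ℕ → (p q : Fin n → ℕ) → ℕ
linProd t s p q = ∏ λ j → p j * t + q j * s

linProdℤ : ℤ → ℤ → (p q : Fin n → ℕ) → ℤ
linProdℤ t s p q = ∏ℤ λ j → + p j ℤ.* t ℤ.+ + q j ℤ.* s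

homEvalℤ-mulLinear : ∀ t s p q carry (cs : Vec ℕ n) →
  homEvalℤ t s (mulLinear p q carry cs)
    ≡ (+ p ℤ.* t ℤ.+ + q ℤ.* s) ℤ.* homEvalℤ t s cs ℤ.+ + carry ℤ.* t ℤ.^ n
homEvalℤ-mulLinear t s p q carry [] = constant-case (+ carry) s (+ p ℤ.* t ℤ.+ + q ℤ.* s)
  where
  constant-case : ∀ C s L → C ℤ.* + 1 ℤ.+ s ℤ.* + 0 ≡ L ℤ.* + 0 ℤ.+ C ℤ.* + 1
  constant-case = solve-∀
homEvalℤ-mulLinear {suc n} t s p q carry (c ∷ cs) = begin
  + (p * c + carry) ℤ.* t ℤ.^ suc n ℤ.+ s ℤ.* homEvalℤ t s (mulLinear p q (q * c) cs)
    ≡⟨ cong₂ (λ x y → x ℤ.* t ℤ.^ suc n ℤ.+ s ℤ.* y) pos-linear tail-eval ⟩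
  (+ p ℤ.* + c ℤ.+ + carry) ℤ.* (t ℤ.* T) ℤ.+ s ℤ.* (L ℤ.* H ℤ.+ + q ℤ.* + c ℤ.* T)
    ≡⟨ distribute t s (+ p) (+ q) (+ c) (+ carry) T H ⟩
  L ℤ.* (+ c ℤ.* T ℤ.+ s ℤ.* H) ℤ.+ + carry ℤ.* (t ℤ.* T) ∎
  where
  open ≡-Reasoning
  L = + p ℤ.* t ℤ.+ + q ℤ.* s
  H = homEvalℤ t s cs
  T = t ℤ.^ n
  pos-linear : + (p * c + carry) ≡ + p ℤ.* + c ℤ.+ + carry
  pos-linear = trans (ℤ.pos-+ (p * c) carry) (cong (ℤ._+ + carry) (ℤ.pos-* p c))
  tail-eval : homEvalℤ t s (mulLinear p q (q * c) cs) ≡ L ℤ.* H ℤ.+ + q ℤ.* + c ℤ.* T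
  tail-eval = trans (homEvalℤ-mulLinear t s p q (q * c) cs)
                    (cong (λ x → L ℤ.* H ℤ.+ x ℤ.* T) (ℤ.pos-* q c))
  distribute : ∀ t s P Q c C T H →
    (P ℤ.* c ℤ.+ C) ℤ.* (t ℤ.* T) ℤ.+ s ℤ.* ((P ℤ.* t ℤ.+ Q ℤ.* s) ℤ.* H ℤ.+ Q ℤ.* c ℤ.* T)
      ≡ (P ℤ.* t ℤ.+ Q ℤ.* s) ℤ.* (c ℤ.* T ℤ.+ s ℤ.* H) ℤ.+ C ℤ.* (t ℤ.* T)
  distribute = solve-∀

homEvalℤ-coeffs : ∀ t s (p q : Fin n → ℕ) → homEvalℤ t s (coeffs p q) ≡ linProdℤ t s p q
homEvalℤ-coeffs {zero}  t s p q = cong (ℤ._+_ ℤ.1ℤ) (ℤ.*-zeroʳ s)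
homEvalℤ-coeffs {suc n} t s p q = begin
  homEvalℤ t s (mulLinear (p zero) (q zero) 0 (coeffs (p ∘ suc) (q ∘ suc)))
    ≡⟨ homEvalℤ-mulLinear t s (p zero) (q zero) 0 (coeffs (p ∘ suc) (q ∘ suc)) ⟩
  L ℤ.* homEvalℤ t s (coeffs (p ∘ suc) (q ∘ suc)) ℤ.+ 0ℤ
    ≡⟨ ℤ.+-identityʳ _ ⟩
  L ℤ.* homEvalℤ t s (coeffs (p ∘ suc) (q ∘ suc))
    ≡⟨ cong (L ℤ.*_) (homEvalℤ-coeffs t s (p ∘ suc) (q ∘ suc)) ⟩
  linProdℤ t s p q ∎
  where
  open ≡-Reasoning
  L = + p zero ℤ.* t ℤ.+ + q zero ℤ.* s

homEval-coeffs : ∀ t s (p q : Fin n → ℕ) → homEval t s (coeffs p q) ≡ linProd t s p q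
homEval-coeffs t s p q = ℤ.+-injective (begin
  + homEval t s (coeffs p q)           ≡⟨ pos-homEval t s (coeffs p q) ⟩
  homEvalℤ (+ t) (+ s) (coeffs p q)    ≡⟨ homEvalℤ-coeffs (+ t) (+ s) p q ⟩
  linProdℤ (+ t) (+ s) p q             ≡⟨ ∏ℤ-cong pos-factor ⟨
  ∏ℤ (+_ ∘ λ j → p j * t + q j * s)    ≡⟨ pos-∏ (λ j → p j * t + q j * s) ⟨
  + linProd t s p q                    ∎)
  where
  open ≡-Reasoning
  pos-factor : ∀ j → + (p j * t + q j * s) ≡ + p j ℤ.* + t ℤ.+ + q j ℤ.* + s
  pos-factor j = trans (ℤ.pos-+ (p j * t) _) (cong₂ ℤ._+_ (ℤ.pos-* (p j) t) (ℤ.pos-* (q j) s))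

∏ℤ-≢0 : (f : Fin n → ℤ) → (∀ j → f j ≢ 0ℤ) → ∏ℤ f ≢ 0ℤ
∏ℤ-≢0 {zero}  f f≢0 ()
∏ℤ-≢0 {suc n} f f≢0 ∏f≡0 with ℤ.i*j≡0⇒i≡0∨j≡0 (f zero) ∏f≡0
... | inj₁ f0≡0    = f≢0 zero f0≡0
... | inj₂ rest≡0 = ∏ℤ-≢0 (f ∘ suc) (f≢0 ∘ suc) rest≡0

linear-at-root : ∀ p q → + p ℤ.* ℤ.- (+ q) ℤ.+ + q ℤ.* + p ≡ 0ℤ
linear-at-root p q = cancel (+ p) (+ q)
  where
  cancel : ∀ P Q → P ℤ.* ℤ.- Q ℤ.+ Q ℤ.* P ≡ + 0
  cancel = solve-∀

linear-root⇒cross : ∀ p q p′ q′ → + p′ ℤ.* ℤ.- (+ q) ℤ.+ + q′ ℤ.* + p ≡ 0ℤ → p′ * q ≡ q′ * p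
linear-root⇒cross p q p′ q′ root = sym (ℤ.+-injective (ℤ.i-j≡0⇒i≡j _ _ (begin
  + (q′ * p) ℤ.- + (p′ * q)            ≡⟨ cong₂ ℤ._-_ (ℤ.pos-* q′ p) (ℤ.pos-* p′ q) ⟩
  + q′ ℤ.* + p ℤ.- + p′ ℤ.* + q        ≡⟨ rearrange (+ p) (+ q) (+ p′) (+ q′) ⟩
  + p′ ℤ.* ℤ.- (+ q) ℤ.+ + q′ ℤ.* + p ≡⟨ root ⟩
  0ℤ                                   ∎)))
  where
  open ≡-Reasoning
  rearrange : ∀ P Q P′ Q′ → Q′ ℤ.* P ℤ.- P′ ℤ.* Q ≡ P′ ℤ.* ℤ.- Q ℤ.+ Q′ ℤ.* P
  rearrange = solve-∀

-- Evaluating at the root (t , s) = (- q₀ , p₀) of the first factor of the left-hand product.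
coeffs-≢ : (p q p′ q′ : Fin (suc n) → ℕ) → (∀ j → p′ j * q zero ≢ q′ j * p zero) →
           coeffs p q ≢ coeffs p′ q′
coeffs-≢ p q p′ q′ no-common-root coeffs≡ =
  ∏ℤ-≢0 _ (λ j → no-common-root j ∘ linear-root⇒cross (p zero) (q zero) (p′ j) (q′ j)) (begin
    linProdℤ t s p′ q′                  ≡⟨ homEvalℤ-coeffs t s p′ q′ ⟨
    homEvalℤ t s (coeffs p′ q′)         ≡⟨ cong (homEvalℤ t s) coeffs≡ ⟨
    homEvalℤ t s (coeffs p q)           ≡⟨ homEvalℤ-coeffs t s p q ⟩
    linProdℤ t s p q                    ≡⟨ cong (ℤ._* rest) (linear-at-root (p zero) (q zero)) ⟩
    0ℤ ℤ.* rest                         ≡⟨ ℤ.*-zeroˡ rest ⟩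
    0ℤ                                  ∎)
  where
  open ≡-Reasoning
  t = ℤ.- (+ q zero)
  s = + p zero
  rest = linProdℤ t s (p ∘ suc) (q ∘ suc)

≤-homEval-1-1 : (cs : Vec ℕ n) → Vec.All (_≤ homEval 1 1 cs) cs
≤-homEval-1-1         []       = []
≤-homEval-1-1 {suc n} (c ∷ cs) rewrite ^-zeroˡ n | *-identityʳ c | *-identityˡ (homEval 1 1 cs) =
  m≤m+n c _ ∷ Vec.map (λ c′≤ → ≤-trans c′≤ (m≤n+m _ c)) (≤-homEval-1-1 cs)

coeffs-≤ : ∀ {N} (p q : Fin n → ℕ) → (∀ j → p j + q j ≤ N) → Vec.All (_≤ N ^ n) (coeffs p q)
coeffs-≤ {n} {N} p q p+q≤N = Vec.map (λ c≤ → ≤-trans c≤ sum≤N^n) (≤-homEval-1-1 (coeffs p q))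
  where
  open ≤-Reasoning
  sum≤N^n : homEval 1 1 (coeffs p q) ≤ N ^ n
  sum≤N^n = begin
    homEval 1 1 (coeffs p q) ≡⟨ homEval-coeffs 1 1 p q ⟩
    linProd 1 1 p q          ≤⟨ ∏-mono-≤ {g = const N} factor≤N ⟩
    ∏ {n} (const N)          ≡⟨ ∏-const n N ⟩
    N ^ n                    ∎
    where
    factor≤N : ∀ j → p j * 1 + q j * 1 ≤ N
    factor≤N j rewrite *-identityʳ (p j) | *-identityʳ (q j) = p+q≤N j

coprime-divisor-^ : ∀ {d t x} k → Coprime d t → d ∣ t ^ k * x → d ∣ x
coprime-divisor-^ {d} {x = x} zero    cop d∣ = subst (d ∣_) (*-identityˡ x) d∣
coprime-divisor-^ {d} {t} {x} (suc k) cop d∣ =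
  coprime-divisor-^ k cop (coprime-divisor cop (subst (d ∣_) (*-assoc t (t ^ k) x) d∣))

∣-∣-exchange : ∀ {a b a′ b′} → a + b ≡ a′ + b′ → ∣ a - a′ ∣ ≡ ∣ b′ - b ∣
∣-∣-exchange {a} {b} {a′} {b′} eq = begin
  ∣ a - a′ ∣             ≡⟨ ∣m+n-m+o∣≡∣n-o∣ b a a′ ⟨
  ∣ b + a - b + a′ ∣     ≡⟨ cong₂ ∣_-_∣ (trans (+-comm b a) eq) (+-comm b a′) ⟩
  ∣ a′ + b′ - a′ + b ∣   ≡⟨ ∣m+n-m+o∣≡∣n-o∣ a′ b′ b ⟩
  ∣ b′ - b ∣             ∎
  where open ≡-Reasoning

collision-∣ : ∀ {s t c c′ x y} k → Coprime s t →
              c * t ^ k + s * x ≡ c′ * t ^ k + s * y → s ∣ ∣ c - c′ ∣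
collision-∣ {s} {t} {c} {c′} {x} {y} k cop eq = coprime-divisor-^ k cop (divides ∣ y - x ∣ (begin
  t ^ k * ∣ c - c′ ∣          ≡⟨ *-comm (t ^ k) ∣ c - c′ ∣ ⟩
  ∣ c - c′ ∣ * t ^ k          ≡⟨ *-distribʳ-∣-∣ (t ^ k) c c′ ⟩
  ∣ c * t ^ k - c′ * t ^ k ∣  ≡⟨ ∣-∣-exchange {c * t ^ k} {s * x} eq ⟩
  ∣ s * y - s * x ∣           ≡⟨ *-distribˡ-∣-∣ s y x ⟨
  s * ∣ y - x ∣               ≡⟨ *-comm s _ ⟩
  ∣ y - x ∣ * s               ∎))
  where open ≡-Reasoning

homEval-collision : ∀ {s t M} {a b : Vec ℕ n} → Coprime s t →
                    homEval t s a ≡ homEval t s b → a ≢ b →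
                    Vec.All (_≤ M) a → Vec.All (_≤ M) b → s ≤ M
homEval-collision {s = zero} _ _ _ _ _ = z≤n
homEval-collision {a = []} {[]} _ _ a≢b _ _ = contradiction refl a≢b
homEval-collision {suc n} {s = s@(suc _)} {t} {M} {c ∷ a} {c′ ∷ b}
                  cop eq a≢b (c≤M ∷ a≤M) (c′≤M ∷ b≤M) with c ≟ c′
... | yes refl = homEval-collision cop tails≡ (a≢b ∘ cong (c ∷_)) a≤M b≤M
  where
  tails≡ : homEval t s a ≡ homEval t s b
  tails≡ = *-cancelˡ-≡ _ _ s (+-cancelˡ-≡ (c * t ^ n) (s * homEval t s a) (s * homEval t s b) eq)
... | no c≢c′ = begin
  s          ≤⟨ ∣⇒≤ ⦃ ≢-nonZero (c≢c′ ∘ ∣m-n∣≡0⇒m≡n) ⦄ s∣c-c′ ⟩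
  ∣ c - c′ ∣ ≤⟨ ∣m-n∣≤m⊔n c c′ ⟩
  c ⊔ c′     ≤⟨ ⊔-lub c≤M c′≤M ⟩
  M          ∎
  where
  open ≤-Reasoning
  s∣c-c′ : s ∣ ∣ c - c′ ∣
  s∣c-c′ = collision-∣ {c = c} {c′} {homEval t s a} {homEval t s b} n cop eq

linProd-≡⇒≤ : ∀ {s t N} → Coprime s t → (p q p′ q′ : Fin (suc n) → ℕ) →
              (∀ j → p′ j * q zero ≢ q′ j * p zero) → linProd t s p q ≡ linProd t s p′ q′ →
              (∀ j → p j + q j ≤ N) → (∀ j → p′ j + q′ j ≤ N) → s ≤ N ^ suc n
linProd-≡⇒≤ {s = s} {t} cop p q p′ q′ no-common-root eq p+q≤N p′+q′≤N =
  homEval-collision cop homEval≡ (coeffs-≢ p q p′ q′ no-common-root)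
                    (coeffs-≤ p q p+q≤N) (coeffs-≤ p′ q′ p′+q′≤N)
  where
  homEval≡ : homEval t s (coeffs p q) ≡ homEval t s (coeffs p′ q′)
  homEval≡ = trans (homEval-coeffs t s p q) (trans eq (sym (homEval-coeffs t s p′ q′)))

affine-products-bound : ∀ {r d N} → Coprime d r → (x y : Fin (suc n) → ℕ) →
                        (∀ j → x j < N) → (∀ j → y j < N) → (∀ j → y j ≢ x zero) →
                        ∏ (λ j → r + d * x j) ≡ ∏ (λ j → r + d * y j) →
                        r ≤ N ^ suc n × d ≤ N ^ suc n
affine-products-bound {n} {r} {d} {N} cop x y x<N y<N y≢x₀ eq =
  linProd-≡⇒≤ (Coprime.sym cop) x (const 1) y (const 1) no-common-rootʳ
    (trans (sym (as-linProdʳ x)) (trans eq (as-linProdʳ y))) (+1≤N x x<N) (+1≤N y y<N) ,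
  linProd-≡⇒≤ cop (const 1) x (const 1) y no-common-rootᵈ
    (trans (sym (as-linProdᵈ x)) (trans eq (as-linProdᵈ y))) x<N y<N
  where
  as-linProdʳ : (z : Fin (suc n) → ℕ) → ∏ (λ j → r + d * z j) ≡ linProd d r z (const 1)
  as-linProdʳ z = ∏-cong λ j → trans (+-comm r _) (cong₂ _+_ (*-comm d (z j)) (sym (*-identityˡ r)))
  as-linProdᵈ : (z : Fin (suc n) → ℕ) → ∏ (λ j → r + d * z j) ≡ linProd r d (const 1) z
  as-linProdᵈ z = ∏-cong λ j → cong₂ _+_ (sym (*-identityˡ r)) (*-comm d (z j))
  no-common-rootʳ : ∀ j → y j * 1 ≢ 1 * x zero
  no-common-rootʳ j rewrite *-identityʳ (y j) | *-identityˡ (x zero) = y≢x₀ j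
  no-common-rootᵈ : ∀ j → 1 * x zero ≢ y j * 1
  no-common-rootᵈ j rewrite *-identityʳ (y j) | *-identityˡ (x zero) = y≢x₀ j ∘ sym
  +1≤N : (z : Fin (suc n) → ℕ) → (∀ j → z j < N) → ∀ j → z j + 1 ≤ N
  +1≤N z z<N j = subst (_≤ N) (+-comm 1 (z j)) (z<N j)

edge-labels-∏ : ∀ {B D r d N} {pair : Fin N → ℕ × ℕ} → PairChoice B D r d N pair →
                (f : Fin n → Fin N) (a b : Fin n → ℕ) → (∀ j → pair (f j) ≡ (a j , b j)) →
                D ^ n * ∏ (λ j → r + d * toℕ (f j)) ≡ ∏ a * ∏ b
edge-labels-∏ {n} {D = D} {r} {d} choice f a b f-edge = begin
  D ^ n * ∏ label            ≡⟨ cong (_* ∏ label) (∏-const n D) ⟨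
  ∏ {n} (const D) * ∏ label  ≡⟨ ∏-distrib-* (const D) label ⟨
  ∏ (λ j → D * label j)      ≡⟨ ∏-cong edge-product ⟩
  ∏ (λ j → a j * b j)        ≡⟨ ∏-distrib-* a b ⟩
  ∏ a * ∏ b                  ∎
  where
  open ≡-Reasoning
  open PairChoice choice
  label : Fin n → ℕ
  label j = r + d * toℕ (f j)
  edge-product : ∀ j → D * label j ≡ a j * b j
  edge-product j = trans (sym (product (f j))) (cong (uncurry _*_) (f-edge j))

module _ {N k} {pair : Fin N → ℕ × ℕ} (cycle : Cycle pair k) where
  open Cycle cycle

  cycle-∏ : ∀ {B D r d} → PairChoice B D r d N pair → 1 ≤ D →
            ∏ (λ j → r + d * toℕ (e j)) ≡ ∏ (λ j → r + d * toℕ (e' j))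
  cycle-∏ {D = D} {r} {d} choice 1≤D = *-cancelˡ-≡ _ _ (D ^ suc m) ⦃ D^k≢0 ⦄ (begin
    D ^ suc m * ∏ (λ j → r + d * toℕ (e j))  ≡⟨ edge-labels-∏ choice e v w e-edge ⟩
    ∏ v * ∏ w                                ≡⟨ cong (_* ∏ w) (∏-rotate v) ⟨
    ∏ (v ∘ next) * ∏ w                       ≡⟨ edge-labels-∏ choice e' (v ∘ next) w e'-edge ⟨
    D ^ suc m * ∏ (λ j → r + d * toℕ (e' j)) ∎)
    where
    open ≡-Reasoning
    D^k≢0 : NonZero (D ^ suc m)
    D^k≢0 = m^n≢0 D (suc m) ⦃ >-nonZero 1≤D ⦄

  e'≢e-zero : ∀ j → e' j ≢ e zero
  e'≢e-zero j e'ⱼ≡e₀ =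
    next-zero≢zero 1≤m (trans (cong next (sym j≡0)) (v-inj (cong proj₁ same-edge)))
    where
    1≤m : 1 ≤ m
    1≤m = s≤s⁻¹ (subst (2 ≤_) k≡ 2≤k)
    same-edge : (v (next j) , w j) ≡ (v zero , w zero)
    same-edge = trans (sym (e'-edge j)) (trans (cong pair e'ⱼ≡e₀) (e-edge zero))
    j≡0 : j ≡ zero
    j≡0 = w-inj (cong proj₂ same-edge)

lemma3 : (n : ℕ) (B : List ℕ) → Unique B → length B ≡ n → All (λ b → 1 ≤ b) B →
         (D d r N : ℕ) → 1 ≤ D → 1 ≤ d → gcd d (D * r) ≡ 1 → 2 * n < N →
         (pair : Fin N → ℕ × ℕ) → PairChoice B D r d N pair →
         (k : ℕ) → Cycle pair k →
         r ≤ N ^ k × d ≤ N ^ k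
lemma3 _ _ _ _ _ D d r N 1≤D _ gcd[d,Dr]≡1 _ pair choice k cycle =
  subst (λ k → r ≤ N ^ k × d ≤ N ^ k) (sym k≡)
    (affine-products-bound coprime (toℕ ∘ e) (toℕ ∘ e') (toℕ<n ∘ e) (toℕ<n ∘ e')
      (λ j → e'≢e-zero cycle j ∘ toℕ-injective) (cycle-∏ cycle choice 1≤D))
  where
  open Cycle cycle
  coprime : Coprime d r
  coprime (i∣d , i∣r) = gcd≡1⇒coprime gcd[d,Dr]≡1 (i∣d , ∣-trans i∣r (n∣m*n D))
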